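{- Let $D_0$ be a diagram. Suppose there exist a diagram $D\in KD(D_0)$ and positive integers $r,r',r_1,r_2,c,c'$ with $1\le r_1,r_2<r<r'$ and $1\le c<c'$ such that: (1) $(\tilde r,c)\in D$ for all $r\le\tilde r\le r'$, and $(r,c')\in D$; (2) $(r',\tilde c)\notin D$ for all $\tilde c>c$; (3) for each $\tilde r$ with $r<\tilde r<r'$ there exists $\tilde c>c$ with $(\tilde r,\tilde c)\in D$; (4) $(r,\tilde c)\notin D$ for all $\tilde c$ with $c<\tilde c<c'$ and for all $\tilde c>c'$; (5) $(r_1,c)\notin D$ and $(r_2,c')\notin D$. Then $\mathcal{P}(D_0)$ is not ranked.
   Context: A diagram is a finite set $D$ of cells $(r,c)$ with $r,c$ positive integers; $r$ is the row (rows numbered from bottom to top starting at 1) and $c$ the column (numbered from left to right starting at 1). A Kohnert move at row $r$ applied to a diagram $D$: if row $r$ of $D$ is empty, $D$ is unchanged; otherwise let $(r,c)$ be the cell of row $r$ with the largest column index; if every position $(r',c)$ with $1\le r'<r$ belongs to $D$, then $D$ is unchanged; otherwise let $r'$ be the largest integer with $1\le r'<r$ and $(r',c)\notin D$, and the move replaces the cell $(r,c)$ by $(r',c)$. For a diagram $D_0$, $KD(D_0)$ is the set of all diagrams obtainable from $D_0$ by finite (possibly empty) sequences of Kohnert moves. The Kohnert poset $\mathcal{P}(D_0)$ is $KD(D_0)$ ordered by $D_2\preceq D_1$ iff $D_2$ can be obtained from $D_1$ by a finite sequence of Kohnert moves. A finite poset $P$ is ranked if there is a function $\rho:P\to\mathbb{Z}_{\ge0}$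 such that $x\prec y$ implies $\rho(x)<\rho(y)$ and $\rho(y)=\rho(x)+1$ whenever $y$ covers $x$. -}

module Defs where

open import Data.Nat using (ℕ; _≤_; _<_; _+_)
open import Data.Product using (_×_; _,_; ∃-syntax; Σ-syntax)
open import Data.Sum using (_⊎_)
open import Data.List using (List)
open import Data.List.Relation.Unary.All using (All)
open import Data.List.Membership.Propositional using (_∈_; _∉_)
open import Relation.Binary.PropositionalEquality using (_≡_; _≢_)
open import Relation.Binary.Construct.Closure.ReflexiveTransitive using (Star)
open import Relation.Nullary using (¬_)
open import Function.Bundles using (_⇔_)

-- A cell (r , c): r = row (counted from the bottom, starting at 1),
-- c = column (counted from the left, starting at 1).
Cell : Set
Cell = ℕ × ℕ

-- A diagram is a finite set of cells, represented by a list of cells;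
-- only membership matters (duplicates / order are irrelevant).
Diagram : Set
Diagram = List Cell

Positive : Cell → Set
Positive (r , c) = (1 ≤ r) × (1 ≤ c)

IsDiagram : Diagram → Set
IsDiagram D = All Positive D

_≈D_ : Diagram → Diagram → Set
D ≈D E = ∀ x → (x ∈ D) ⇔ (x ∈ E)

-- One (non-trivial) Kohnert move at row r: (r , c) is the rightmost cell
-- of row r, r' is the largest row index 1 ≤ r' < r with (r' , c) ∉ D, and
-- the cell (r , c) is replaced by (r' , c).  Moves that leave D unchanged
-- are irrelevant since we take the reflexive-transitive closure.
KohnertMove : Diagram → Diagram → Set
KohnertMove D E =
  ∃[ r ] ∃[ c ] ∃[ r' ]
    ( (r , c) ∈ D
    × (∀ c₁ → c < c₁ → (r , c₁) ∉ D)
    × 1 ≤ r' × r' < r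
    × (r' , c) ∉ D
    × (∀ r₁ → r' < r₁ → r₁ < r → (r₁ , c) ∈ D)
    × (∀ x → (x ∈ E) ⇔ ((x ∈ D × x ≢ (r , c)) ⊎ x ≡ (r' , c))) )

Reach : Diagram → Diagram → Set
Reach D E = Star KohnertMove D E

InKD : Diagram → Diagram → Set
InKD D₀ D = Reach D₀ D

_⪯_ : Diagram → Diagram → Set
D₂ ⪯ D₁ = Reach D₁ D₂

_≺_ : Diagram → Diagram → Set
D₂ ≺ D₁ = (D₂ ⪯ D₁) × ¬ (D₂ ≈D D₁)

Covers : Diagram → Diagram → Diagram → Set
Covers D₀ y x = (x ≺ y) × (∀ z → InKD D₀ z → ¬ ((x ≺ z) × (z ≺ y)))

-- 𝒫(D₀) is ranked: a rank function on the elements of KD(D₀)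
-- (well-defined on sets of cells, i.e. respecting ≈D).
Ranked : Diagram → Set
Ranked D₀ =
  Σ[ ρ ∈ (Diagram → ℕ) ]
    ( (∀ x y → InKD D₀ x → InKD D₀ y → x ≈D y → ρ x ≡ ρ y)
    × (∀ x y → InKD D₀ x → InKD D₀ y → x ≺ y → ρ x < ρ y)
    × (∀ x y → InKD D₀ x → InKD D₀ y → Covers D₀ y x → ρ y ≡ ρ x + 1) )

-- A Kohnert move lowers one cell inside its column, so for every column j
-- and height h the number of cells of column j below row h never decreases
-- along moves, and it strictly increases at the height of the moved cell.
-- Hence the Kohnert order is acyclic, and a move whose passed rows all
-- extend to the right of the moving cell is a cover: any other first move
-- raises a count that the target diagram does not.
--
-- After moving at most one cell in each of the columns c' and c, both
-- columns have an empty cell below row r above which every row extends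
-- right.  Dropping (r',c) and then (r,c') into these gaps gives two covers
-- D ⋗ X ⋗ Z, while moving (r,c'), then (r,c), then (r',c) (which now stops
-- at row r) gives a chain D > Y > Y' > Z.  A rank function would have to
-- drop by 2 and by at least 3 from D to Z.

module Submission where

open import Defs
open import Data.Nat using (ℕ; zero; suc; _+_; _≤_; _<_; _≟_; _<?_; z≤n; s≤s; z<s)
open import Data.Nat.Properties
open import Data.Product using (∃-syntax; _×_; _,_; proj₁; proj₂; uncurry)
open import Data.Product.Properties using (≡-dec; ,-injectiveˡ; ,-injectiveʳ)
open import Data.Sum using (_⊎_; inj₁; inj₂; [_,_]′)
open import Data.List using (_∷_; filter)
open import Data.List.Relation.Unary.Any using (Any; here; there; any?)
open import Data.List.Membership.Propositional using (_∈_; _∉_; find; lose)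
open import Data.List.Membership.Propositional.Properties using (∈-filter⁺; ∈-filter⁻)
open import Data.Empty using (⊥; ⊥-elim)
open import Function using (_∘_)
open import Function.Bundles using (_⇔_; mk⇔; Equivalence)
import Function.Properties.Equivalence as ⇔
open import Relation.Binary.PropositionalEquality
open import Relation.Binary.Construct.Closure.ReflexiveTransitive using (ε; _◅_; _◅◅_)
open import Relation.Binary.Definitions using (DecidableEquality; tri<; tri≈; tri>)
open import Relation.Nullary using (¬_; Dec; yes; no; contradiction)
open import Relation.Nullary.Decidable using (_×-dec_; ¬?; map′)
open import Relation.Unary using (Decidable)
open import Algebra.Properties.CommutativeSemigroup +-commutativeSemigroup using (interchange)

open Equivalence using (to; from)

private
  variable
    A B : Set
    D D' D₀ D₁ E E' F : Diagram
    P P' Q Q' u : Cell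
    a b b' h i j j' p r r₀ : ℕ
    f f' g g' : ℕ → ℕ

χ : Dec A → ℕ
χ (yes _) = 1
χ (no _)  = 0

χ-yes : A → (a? : Dec A) → χ a? ≡ 1
χ-yes x (yes _) = refl
χ-yes x (no ¬x) = contradiction x ¬x

χ-no : ¬ A → (a? : Dec A) → χ a? ≡ 0
χ-no ¬x (yes x) = contradiction x ¬x
χ-no ¬x (no _)  = refl

χ-mono : (A → B) → (a? : Dec A) (b? : Dec B) → χ a? ≤ χ b?
χ-mono f (yes x) (yes _) = ≤-refl
χ-mono f (yes x) (no ¬y) = contradiction (f x) ¬y
χ-mono f (no _)  _       = z≤n

χ-cong : A ⇔ B → (a? : Dec A) (b? : Dec B) → χ a? ≡ χ b?
χ-cong A⇔B a? b? = ≤-antisym (χ-mono (to A⇔B) a? b?) (χ-mono (from A⇔B) b? a?)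

Σ< : ℕ → (ℕ → ℕ) → ℕ
Σ< zero    f = 0
Σ< (suc n) f = f n + Σ< n f

Σ<-cong : (∀ i → f i ≡ g i) → ∀ n → Σ< n f ≡ Σ< n g
Σ<-cong f≡g zero    = refl
Σ<-cong f≡g (suc n) = cong₂ _+_ (f≡g n) (Σ<-cong f≡g n)

Σ<-balance : (∀ i → f i + g i ≡ f' i + g' i) → ∀ n → Σ< n f + Σ< n g ≡ Σ< n f' + Σ< n g'
Σ<-balance e zero = refl
Σ<-balance {f} {g} {f'} {g'} e (suc n) = begin
  (f n + Σ< n f) + (g n + Σ< n g)        ≡⟨ interchange (f n) _ (g n) _ ⟩
  (f n + g n) + (Σ< n f + Σ< n g)        ≡⟨ cong₂ _+_ (e n) (Σ<-balance e n) ⟩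
  (f' n + g' n) + (Σ< n f' + Σ< n g')    ≡⟨ interchange (f' n) (g' n) _ _ ⟩
  (f' n + Σ< n f') + (g' n + Σ< n g')    ∎
  where open ≡-Reasoning

Σ<-indicator : ∀ a n → Σ< n (λ i → χ (i ≟ a)) ≡ χ (a <? n)
Σ<-indicator a zero    = sym (χ-no (λ ()) (a <? 0))
Σ<-indicator a (suc n) = trans (cong (χ (n ≟ a) +_) (Σ<-indicator a n)) (last (n ≟ a))
  where
  last : (n≟a : Dec (n ≡ a)) → χ n≟a + χ (a <? n) ≡ χ (a <? suc n)
  last (yes refl) = trans (cong suc (χ-no (<-irrefl refl) _)) (sym (χ-yes (n<1+n a) _))
  last (no n≢a)   = χ-cong (mk⇔ m<n⇒m<1+n (λ a<1+n → ≤∧≢⇒< (≤-pred a<1+n) (n≢a ∘ sym))) _ _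

balance⇒≤ : ∀ {m n k l} → m + k ≡ n + l → k ≤ l → n ≤ m
balance⇒≤ {m} {n} {k} e k≤l = +-cancelʳ-≤ k n m (≤-trans (+-monoʳ-≤ n k≤l) (≤-reflexive (sym e)))

≢-row : a ≢ b → (a , i) ≢ (b , j)
≢-row a≢b = a≢b ∘ ,-injectiveˡ

≢-col : i ≢ j → (a , i) ≢ (b , j)
≢-col i≢j = i≢j ∘ ,-injectiveʳ

_≟ᶜ_ : DecidableEquality Cell
_≟ᶜ_ = ≡-dec _≟_ _≟_

open import Data.List.Membership.DecPropositional _≟ᶜ_ using (_∈?_)

≈D-refl : D ≈D D
≈D-refl x = ⇔.refl

≈D-sym : D ≈D E → E ≈D D
≈D-sym D≈E x = ⇔.sym (D≈E x)

≈D-trans : D ≈D E → E ≈D F → D ≈D F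
≈D-trans D≈E E≈F x = ⇔.trans (D≈E x) (E≈F x)

HasCellRightOf : Diagram → ℕ → ℕ → Set
HasCellRightOf D p j = ∃[ c₁ ] (j < c₁ × (p , c₁) ∈ D)

NoCellRightOf : Diagram → ℕ → ℕ → Set
NoCellRightOf D p j = ∀ c₁ → j < c₁ → (p , c₁) ∉ D

hasCellRightOf? : ∀ D p j → Dec (HasCellRightOf D p j)
hasCellRightOf? D p j = map′ fromAny toAny (any? (λ x → (proj₁ x ≟ p) ×-dec (j <? proj₂ x)) D)
  where
  fromAny : Any (λ x → proj₁ x ≡ p × j < proj₂ x) D → HasCellRightOf D p j
  fromAny cell with find cell
  ... | (_ , c₁) , x∈D , refl , j<c₁ = c₁ , j<c₁ , x∈D
  toAny : HasCellRightOf D p j → Any (λ x → proj₁ x ≡ p × j < proj₂ x) D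
  toAny (c₁ , j<c₁ , x∈D) = lose x∈D (refl , j<c₁)

hasCellRightOf-map : (∀ c₁ → j < c₁ → (p , c₁) ∈ D → (p , c₁) ∈ D') →
  HasCellRightOf D p j → HasCellRightOf D' p j
hasCellRightOf-map f (c₁ , j<c₁ , x∈D) = c₁ , j<c₁ , f c₁ j<c₁ x∈D

KohnertMoveAt : Diagram → Diagram → ℕ → ℕ → ℕ → Set
KohnertMoveAt D E a j b =
    (a , j) ∈ D
  × NoCellRightOf D a j
  × 1 ≤ b × b < a
  × (b , j) ∉ D
  × (∀ p → b < p → p < a → (p , j) ∈ D)
  × (∀ x → (x ∈ E) ⇔ ((x ∈ D × x ≢ (a , j)) ⊎ x ≡ (b , j)))

∈-move-elsewhere : KohnertMoveAt D E a j b → u ≢ (a , j) → u ≢ (b , j) → u ∈ E ⇔ u ∈ D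
∈-move-elsewhere (_ , _ , _ , _ , _ , _ , E⇔) u≢P u≢Q =
  ⇔.trans (E⇔ _) (mk⇔ [ proj₁ , (λ u≡Q → contradiction u≡Q u≢Q) ]′ (λ u∈D → inj₁ (u∈D , u≢P)))

move-source-∉ : KohnertMoveAt D E a j b → (a , j) ∉ E
move-source-∉ (_ , _ , _ , b<a , _ , _ , E⇔) a∈E =
  [ (λ (_ , P≢P) → P≢P refl) , ≢-row (>⇒≢ b<a) ]′ (to (E⇔ _) a∈E)

move-target-∈ : KohnertMoveAt D E a j b → (b , j) ∈ E
move-target-∈ (_ , _ , _ , _ , _ , _ , E⇔) = from (E⇔ _) (inj₂ refl)

move-resp-≈ : KohnertMoveAt D E a j b → E ≈D E' → KohnertMoveAt D E' a j b
move-resp-≈ (a∈ , ends , 1≤b , b<a , b∉ , filled , E⇔) E≈E' =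
  a∈ , ends , 1≤b , b<a , b∉ , filled , λ x → ⇔.trans (⇔.sym (E≈E' x)) (E⇔ x)

landing-unique : KohnertMoveAt D E a j b → KohnertMoveAt D E' a j b' → b ≡ b'
landing-unique (_ , _ , _ , b<a , b∉ , filled , _) (_ , _ , _ , b'<a , b'∉ , filled' , _) =
  ≤-antisym (≮⇒≥ λ b'<b → b∉ (filled' _ b'<b b<a)) (≮⇒≥ λ b<b' → b'∉ (filled _ b<b' b'<a))

move-deterministic : KohnertMoveAt D E a j b → KohnertMoveAt D E' a j b' → E ≈D E'
move-deterministic m@(_ , _ , _ , _ , _ , _ , E⇔) m'@(_ , _ , _ , _ , _ , _ , E'⇔)
  with landing-unique m m'
... | refl = λ x → ⇔.trans (E⇔ x) (⇔.sym (E'⇔ x))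

ι : Diagram → Cell → ℕ
ι D x = χ (x ∈? D)

opaque
  cellsBelow : Diagram → ℕ → ℕ → ℕ
  cellsBelow D j h = Σ< h (λ i → ι D (i , j))

ι-move-column : KohnertMoveAt D E a j b → ∀ i → ι E (i , j) + χ (i ≟ a) ≡ ι D (i , j) + χ (i ≟ b)
ι-move-column {a = a} {b = b} m@(a∈D , _ , _ , b<a , b∉D , _ , _) i with i ≟ a | i ≟ b
... | yes refl | yes refl = contradiction b<a (<-irrefl refl)
... | yes refl | no _     = trans (cong (_+ 1) (χ-no (move-source-∉ m) _)) (cong (_+ 0) (sym (χ-yes a∈D _)))
... | no _     | yes refl = trans (cong (_+ 0) (χ-yes (move-target-∈ m) _)) (cong (_+ 1) (sym (χ-no b∉D _)))
... | no i≢a   | no i≢b   = cong (_+ 0) (χ-cong (∈-move-elsewhere m (≢-row i≢a) (≢-row i≢b)) _ _)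

opaque
  unfolding cellsBelow

  cellsBelow-resp-≈ : D ≈D E → ∀ j h → cellsBelow D j h ≡ cellsBelow E j h
  cellsBelow-resp-≈ D≈E j = Σ<-cong (λ i → χ-cong (D≈E (i , j)) _ _)

  cellsBelow-move-column : KohnertMoveAt D E a j b →
    ∀ h → cellsBelow E j h + χ (a <? h) ≡ cellsBelow D j h + χ (b <? h)
  cellsBelow-move-column {D} {E} {a} {j} {b} m h = begin
    cellsBelow E j h + χ (a <? h)                    ≡⟨ cong (cellsBelow E j h +_) (sym (Σ<-indicator a h)) ⟩
    cellsBelow E j h + Σ< h (λ i → χ (i ≟ a))        ≡⟨ Σ<-balance (ι-move-column m) h ⟩
    cellsBelow D j h + Σ< h (λ i → χ (i ≟ b))        ≡⟨ cong (cellsBelow D j h +_) (Σ<-indicator b h) ⟩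
    cellsBelow D j h + χ (b <? h)                    ∎
    where open ≡-Reasoning

  cellsBelow-move-other : KohnertMoveAt D E a j b → j' ≢ j → cellsBelow E j' h ≡ cellsBelow D j' h
  cellsBelow-move-other {h = h} m j'≢j =
    Σ<-cong (λ i → χ-cong (∈-move-elsewhere m (≢-col j'≢j) (≢-col j'≢j)) _ _) h

cellsBelow-move-≤ : KohnertMoveAt D E a j b → ∀ j' h → cellsBelow D j' h ≤ cellsBelow E j' h
cellsBelow-move-≤ {j = j} m@(_ , _ , _ , b<a , _) j' h with j' ≟ j
... | no j'≢j = ≤-reflexive (sym (cellsBelow-move-other m j'≢j))
... | yes refl = balance⇒≤ (cellsBelow-move-column m h) (χ-mono (<-trans b<a) _ _)

cellsBelow-move-< : KohnertMoveAt D E a j b → cellsBelow D j a < cellsBelow E j a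
cellsBelow-move-< {D} {E} {a} {j} {b} m@(_ , _ , _ , b<a , _) = begin-strict
  cellsBelow D j a                  <⟨ m<m+n _ z<s ⟩
  cellsBelow D j a + 1              ≡⟨ cong (cellsBelow D j a +_) (sym (χ-yes b<a (b <? a))) ⟩
  cellsBelow D j a + χ (b <? a)     ≡⟨ sym (cellsBelow-move-column m a) ⟩
  cellsBelow E j a + χ (a <? a)     ≡⟨ cong (cellsBelow E j a +_) (χ-no (<-irrefl refl) (a <? a)) ⟩
  cellsBelow E j a + 0              ≡⟨ +-identityʳ _ ⟩
  cellsBelow E j a                  ∎
  where open ≤-Reasoning

cellsBelow-move-outside : KohnertMoveAt D E a j b → (j' ≡ j → b < h → a < h) →
  cellsBelow E j' h ≡ cellsBelow D j' h
cellsBelow-move-outside {D} {a = a} {j = j} {b = b} {j' = j'} {h = h} m@(_ , _ , _ , b<a , _) outside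
  with j' ≟ j
... | no j'≢j = cellsBelow-move-other m j'≢j
... | yes refl = +-cancelʳ-≡ (χ (a <? h)) _ _
  (trans (cellsBelow-move-column m h)
         (cong (cellsBelow D j h +_) (χ-cong (mk⇔ (outside refl) (<-trans b<a)) (b <? h) (a <? h))))

cellsBelow-reach-≤ : Reach D E → ∀ j h → cellsBelow D j h ≤ cellsBelow E j h
cellsBelow-reach-≤ ε                      j h = ≤-refl
cellsBelow-reach-≤ ((_ , _ , _ , m) ◅ ms) j h = ≤-trans (cellsBelow-move-≤ m j h) (cellsBelow-reach-≤ ms j h)

move-reach-≉ : KohnertMove D D₁ → Reach D₁ E → ¬ (E ≈D D)
move-reach-≉ {D} {D₁} {E} (a , j , _ , m) D₁→E E≈D = <-irrefl refl (begin-strict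
  cellsBelow D j a    <⟨ cellsBelow-move-< m ⟩
  cellsBelow D₁ j a   ≤⟨ cellsBelow-reach-≤ D₁→E j a ⟩
  cellsBelow E j a    ≡⟨ cellsBelow-resp-≈ E≈D j a ⟩
  cellsBelow D j a    ∎)
  where open ≤-Reasoning

reach-antisym : Reach D E → Reach E F → D ≈D F → E ≈D F
reach-antisym ε              _   D≈F = D≈F
reach-antisym (m ◅ D₁→E) E→F D≈F = ⊥-elim (move-reach-≉ m (D₁→E ◅◅ E→F) (≈D-sym D≈F))

move⇒≺ : KohnertMoveAt D E a j b → E ≺ D
move⇒≺ m = (_ , _ , _ , m) ◅ ε , move-reach-≉ (_ , _ , _ , m) ε

row-end-above-segment : (∀ p → b < p → p < a → HasCellRightOf D p j) → NoCellRightOf D p j' →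
  (p , j') ≢ (a , j) → j' ≡ j → b < p → a < p
row-end-above-segment {b} {a} {p = p} extends ends other refl b<p with <-cmp a p
... | tri< a<p _ _ = a<p
... | tri≈ _ refl _ = contradiction refl other
... | tri> _ _ p<a = let c₁ , j<c₁ , p∈ = extends p b<p p<a in contradiction p∈ (ends c₁ j<c₁)

move-covers : KohnertMoveAt D E a j b → (∀ p → b < p → p < a → HasCellRightOf D p j) →
  Covers D₀ D E
move-covers {D} {E} {a} {j} {b} m extends =
  move⇒≺ m , λ F _ ((F→E , E≉F) , (D→F , F≉D)) → no-between D→F F→E E≉F F≉D
  where
  open ≤-Reasoning
  no-between : Reach D F → Reach F E → ¬ E ≈D F → ¬ F ≈D D → ⊥
  no-between ε _ _ D≉D = D≉D ≈D-refl
  no-between ((p , j' , q , m₁@(_ , ends , _)) ◅ D₁→F) F→E E≉F _ with (p , j') ≟ᶜ (a , j)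
  ... | yes refl = E≉F (≈D-sym (reach-antisym D₁→F F→E (move-deterministic m₁ m)))
  ... | no other = <-irrefl refl (begin-strict
    cellsBelow D j' p   <⟨ cellsBelow-move-< m₁ ⟩
    cellsBelow _ j' p   ≤⟨ cellsBelow-reach-≤ (D₁→F ◅◅ F→E) j' p ⟩
    cellsBelow E j' p   ≡⟨ cellsBelow-move-outside m (row-end-above-segment extends ends other) ⟩
    cellsBelow D j' p   ∎)

opaque
  relocate : Cell → Cell → Diagram → Diagram
  relocate P Q D = Q ∷ filter (λ x → ¬? (x ≟ᶜ P)) D

opaque
  unfolding relocate

  ∈-relocate⁺ : u ∈ D → u ≢ P → u ∈ relocate P Q D
  ∈-relocate⁺ {P = P} u∈D u≢P = there (∈-filter⁺ (λ x → ¬? (x ≟ᶜ P)) u∈D u≢P)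

  ∈-relocate-target : Q ∈ relocate P Q D
  ∈-relocate-target = here refl

  ∈-relocate⁻ : u ∈ relocate P Q D → (u ∈ D × u ≢ P) ⊎ u ≡ Q
  ∈-relocate⁻ (here u≡Q)         = inj₂ u≡Q
  ∈-relocate⁻ {P = P} (there u∈) = inj₁ (∈-filter⁻ (λ x → ¬? (x ≟ᶜ P)) u∈)

∉-relocate : u ∉ D → u ≢ Q → u ∉ relocate P Q D
∉-relocate u∉D u≢Q u∈ = [ u∉D ∘ proj₁ , u≢Q ]′ (∈-relocate⁻ u∈)

source-∉-relocate : P ≢ Q → P ∉ relocate P Q D
source-∉-relocate P≢Q P∈ = [ (λ (_ , P≢P) → P≢P refl) , P≢Q ]′ (∈-relocate⁻ P∈)

relocate-move : (a , j) ∈ D → NoCellRightOf D a j → 1 ≤ b → b < a → (b , j) ∉ D →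
  (∀ p → b < p → p < a → (p , j) ∈ D) → KohnertMoveAt D (relocate (a , j) (b , j) D) a j b
relocate-move a∈ ends 1≤b b<a b∉ filled =
  a∈ , ends , 1≤b , b<a , b∉ , filled ,
  λ x → mk⇔ ∈-relocate⁻ [ uncurry ∈-relocate⁺ , (λ { refl → ∈-relocate-target }) ]′

relocate-comm-⊆ : P ≢ Q' → P' ≢ Q →
  u ∈ relocate P Q (relocate P' Q' D) → u ∈ relocate P' Q' (relocate P Q D)
relocate-comm-⊆ {P} {Q'} {P'} {Q} {D = D} P≢Q' P'≢Q u∈
  with ∈-relocate⁻ {P = P} {Q = Q} {D = relocate P' Q' D} u∈
... | inj₂ refl = ∈-relocate⁺ ∈-relocate-target (P'≢Q ∘ sym)
... | inj₁ (u∈' , u≢P) with ∈-relocate⁻ {P = P'} {Q = Q'} {D = D} u∈'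
...   | inj₂ refl         = ∈-relocate-target
...   | inj₁ (u∈D , u≢P') = ∈-relocate⁺ (∈-relocate⁺ u∈D u≢P) u≢P'

relocate-comm : P ≢ Q' → P' ≢ Q → relocate P Q (relocate P' Q' D) ≈D relocate P' Q' (relocate P Q D)
relocate-comm P≢Q' P'≢Q x = mk⇔ (relocate-comm-⊆ P≢Q' P'≢Q) (relocate-comm-⊆ P'≢Q P≢Q')

relocate-chain : P ∈ D → P ≢ P' → P' ≢ Q → relocate P' P (relocate P Q D) ≈D relocate P' Q D
relocate-chain {P} {D} {P'} {Q} P∈D P≢P' P'≢Q x = mk⇔ forward backward
  where
  forward : x ∈ relocate P' P (relocate P Q D) → x ∈ relocate P' Q D
  forward x∈ with ∈-relocate⁻ {P = P'} {Q = P} {D = relocate P Q D} x∈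
  ... | inj₂ refl = ∈-relocate⁺ P∈D P≢P'
  ... | inj₁ (x∈' , x≢P') with ∈-relocate⁻ {P = P} {Q = Q} {D = D} x∈'
  ...   | inj₂ refl        = ∈-relocate-target
  ...   | inj₁ (x∈D , x≢P) = ∈-relocate⁺ x∈D x≢P'
  backward : x ∈ relocate P' Q D → x ∈ relocate P' P (relocate P Q D)
  backward x∈ with ∈-relocate⁻ {P = P'} {Q = Q} {D = D} x∈ | x ≟ᶜ P
  ... | inj₂ refl        | _        = ∈-relocate⁺ ∈-relocate-target (P'≢Q ∘ sym)
  ... | inj₁ _           | yes refl = ∈-relocate-target
  ... | inj₁ (x∈D , x≢P') | no x≢P  = ∈-relocate⁺ (∈-relocate⁺ x∈D x≢P) x≢P'

lastFailureBelow : {R : ℕ → Set} → Decidable R → ¬ R r₀ → r₀ < r →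
  ∃[ s ] (r₀ ≤ s × s < r × ¬ R s × (∀ p → s < p → p < r → R p))
lastFailureBelow {r₀} {suc r} {R} R? ¬Rr₀ r₀<1+r with R? r
... | no ¬Rr =
  r , ≤-pred r₀<1+r , n<1+n r , ¬Rr , λ p r<p p<1+r → contradiction (≤-pred p<1+r) (<⇒≱ r<p)
... | yes Rr
  with lastFailureBelow R? ¬Rr₀ (≤∧≢⇒< (≤-pred r₀<1+r) (λ r₀≡r → ¬Rr₀ (subst R (sym r₀≡r) Rr)))
...   | s , r₀≤s , s<r , ¬Rs , above = s , r₀≤s , m<n⇒m<1+n s<r , ¬Rs , extend
  where
  extend : ∀ p → s < p → p < suc r → R p
  extend p s<p p<1+r with p ≟ r
  ... | yes refl = Rr
  ... | no p≢r   = above p s<p (≤∧≢⇒< (≤-pred p<1+r) p≢r)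

AgreeOn : (Cell → Set) → Diagram → Diagram → Set
AgreeOn R D D' = ∀ x → R x → (x ∈ D ⇔ x ∈ D')

-- A move in column j that passes every row between `row` and r lands at
-- `row`, and these rows extend to the right, as `move-covers` requires.
record GapBelow (D : Diagram) (r j : ℕ) : Set where
  field
    row    : ℕ
    1≤row  : 1 ≤ row
    row<r  : row < r
    empty  : (row , j) ∉ D
    above  : ∀ p → row < p → p < r → (p , j) ∈ D × HasCellRightOf D p j

GapBelow-transfer : AgreeOn (λ x → proj₂ x ≢ j) D D' → j < j' → GapBelow D r j' → GapBelow D' r j'
GapBelow-transfer agree j<j' gap = record
  { row = row ; 1≤row = 1≤row ; row<r = row<r
  ; empty = empty ∘ from (agree _ (>⇒≢ j<j'))
  ; above = λ p row<p p<r → let p∈ , ext = above p row<p p<r in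
      to (agree _ (>⇒≢ j<j')) p∈ ,
      hasCellRightOf-map (λ _ j'<c₁ → to (agree _ (>⇒≢ (<-trans j<j' j'<c₁)))) ext
  }
  where open GapBelow gap

openGap : ∀ j → 1 ≤ r₀ → r₀ < r → (r₀ , j) ∉ D →
  ∃[ D' ] (Reach D D' × AgreeOn (λ x → proj₂ x ≢ j ⊎ r ≤ proj₁ x) D D' × GapBelow D' r j)
openGap {r₀} {r} {D} j 1≤r₀ r₀<r r₀∉
  with lastFailureBelow (λ p → ((p , j) ∈? D) ×-dec hasCellRightOf? D p j) (r₀∉ ∘ proj₁) r₀<r
... | s , r₀≤s , s<r , s-bad , good with (s , j) ∈? D
...   | no s∉ = D , ε , (λ _ _ → ⇔.refl) ,
          record { row = s ; 1≤row = ≤-trans 1≤r₀ r₀≤s ; row<r = s<r ; empty = s∉ ; above = good }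
...   | yes s∈ with lastFailureBelow (λ p → (p , j) ∈? D) r₀∉
                      (≤∧≢⇒< r₀≤s (λ r₀≡s → r₀∉ (subst (λ x → (x , j) ∈ D) (sym r₀≡s) s∈)))
...     | q , r₀≤q , q<s , q∉ , filled = relocate (s , j) (q , j) D , (s , j , q , move) ◅ ε , agree , gap
  where
  move : KohnertMoveAt D (relocate (s , j) (q , j) D) s j q
  move = relocate-move s∈ (λ c₁ j<c₁ sc₁∈ → s-bad (s∈ , c₁ , j<c₁ , sc₁∈))
    (≤-trans 1≤r₀ r₀≤q) q<s q∉ filled
  agree : AgreeOn (λ x → proj₂ x ≢ j ⊎ r ≤ proj₁ x) D (relocate (s , j) (q , j) D)
  agree (a , b) (inj₁ b≢j) = ⇔.sym (∈-move-elsewhere move (≢-col b≢j) (≢-col b≢j))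
  agree (a , b) (inj₂ r≤a) = ⇔.sym (∈-move-elsewhere move
    (≢-row (>⇒≢ (<-≤-trans s<r r≤a))) (≢-row (>⇒≢ (<-≤-trans (<-trans q<s s<r) r≤a))))
  gap : GapBelow (relocate (s , j) (q , j) D) r j
  gap = record
    { row = s ; 1≤row = ≤-trans 1≤r₀ r₀≤s ; row<r = s<r
    ; empty = source-∉-relocate (≢-row (>⇒≢ q<s))
    ; above = λ p s<p p<r → let p∈ , ext = good p s<p p<r in
        ∈-relocate⁺ p∈ (≢-row (>⇒≢ s<p)) ,
        hasCellRightOf-map (λ _ _ pc₁∈ → ∈-relocate⁺ pc₁∈ (≢-row (>⇒≢ s<p))) ext
    }

record Pattern (D : Diagram) (r r' c c' : ℕ) : Set where
  field
    r<r'           : r < r'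
    c<c'           : c < c'
    column         : ∀ r̃ → r ≤ r̃ → r̃ ≤ r' → (r̃ , c) ∈ D
    corner         : (r , c') ∈ D
    top-ends       : NoCellRightOf D r' c
    middle-extends : ∀ r̃ → r < r̃ → r̃ < r' → HasCellRightOf D r̃ c
    row-skips      : ∀ c̃ → c < c̃ → c̃ < c' → (r , c̃) ∉ D
    row-ends       : NoCellRightOf D r c'

Pattern-transfer : ∀ {r' c c'} → AgreeOn (λ x → r ≤ proj₁ x) D D' →
  Pattern D r r' c c' → Pattern D' r r' c c'
Pattern-transfer agree pat = record
  { r<r' = r<r' ; c<c' = c<c'
  ; column = λ r̃ r≤r̃ r̃≤r' → to (agree _ r≤r̃) (column r̃ r≤r̃ r̃≤r')
  ; corner = to (agree _ ≤-refl) corner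
  ; top-ends = λ c₁ c<c₁ → top-ends c₁ c<c₁ ∘ from (agree _ (<⇒≤ r<r'))
  ; middle-extends = λ r̃ r<r̃ r̃<r' →
      hasCellRightOf-map (λ _ _ → to (agree _ (<⇒≤ r<r̃))) (middle-extends r̃ r<r̃ r̃<r')
  ; row-skips = λ c̃ c<c̃ c̃<c' → row-skips c̃ c<c̃ c̃<c' ∘ from (agree _ ≤-refl)
  ; row-ends = λ c₁ c'<c₁ → row-ends c₁ c'<c₁ ∘ from (agree _ ≤-refl)
  }
  where open Pattern pat

¬Ranked-of-chains : ∀ {top mid bot w₁ w₂} → InKD D₀ top → Covers D₀ top mid → Covers D₀ mid bot →
  bot ≺ w₁ → w₁ ≺ w₂ → w₂ ≺ top → ¬ Ranked D₀
¬Ranked-of-chains {D₀} {top} {mid} {bot} {w₁} {w₂} top∈ top⋗mid mid⋗bot bot≺w₁ w₁≺w₂ w₂≺top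
  (ρ , _ , mono , cover) = <-irrefl refl (begin-strict
    ρ top               ≡⟨ rank-suc top∈ mid∈ top⋗mid ⟩
    suc (ρ mid)         ≡⟨ cong suc (rank-suc mid∈ bot∈ mid⋗bot) ⟩
    suc (suc (ρ bot))   ≤⟨ s≤s (mono _ _ bot∈ w₁∈ bot≺w₁) ⟩
    suc (ρ w₁)          ≤⟨ mono _ _ w₁∈ w₂∈ w₁≺w₂ ⟩
    ρ w₂                <⟨ mono _ _ w₂∈ top∈ w₂≺top ⟩
    ρ top               ∎)
  where
  open ≤-Reasoning
  rank-suc : ∀ {y x} → InKD D₀ y → InKD D₀ x → Covers D₀ y x → ρ y ≡ suc (ρ x)
  rank-suc y∈ x∈ y⋗x = trans (cover _ _ x∈ y∈ y⋗x) (+-comm _ 1)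
  mid∈ : InKD D₀ mid
  mid∈ = top∈ ◅◅ proj₁ (proj₁ top⋗mid)
  bot∈ : InKD D₀ bot
  bot∈ = mid∈ ◅◅ proj₁ (proj₁ mid⋗bot)
  w₂∈ : InKD D₀ w₂
  w₂∈ = top∈ ◅◅ proj₁ w₂≺top
  w₁∈ : InKD D₀ w₁
  w₁∈ = w₂∈ ◅◅ proj₁ w₁≺w₂

module TwoChains {D : Diagram} {r r' c c' : ℕ}
  (pat : Pattern D r r' c c') (gap : GapBelow D r c) (gap' : GapBelow D r c') where

  open Pattern pat
  open GapBelow gap renaming (row to s; 1≤row to 1≤s; row<r to s<r; empty to s-empty; above to s-above)
  open GapBelow gap' renaming (row to t; 1≤row to 1≤t; row<r to t<r; empty to t-empty; above to t-above)

  X Z Y Y' : Diagram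
  X  = relocate (r' , c) (s , c) D
  Z  = relocate (r , c') (t , c') X
  Y  = relocate (r , c') (t , c') D
  Y' = relocate (r , c) (s , c) Y

  D→X : KohnertMoveAt D X r' c s
  D→X = relocate-move (column r' (<⇒≤ r<r') ≤-refl) top-ends 1≤s (<-trans s<r r<r') s-empty filled
    where
    filled : ∀ p → s < p → p < r' → (p , c) ∈ D
    filled p s<p p<r' with p <? r
    ... | yes p<r = proj₁ (s-above p s<p p<r)
    ... | no p≮r  = column p (≮⇒≥ p≮r) (<⇒≤ p<r')

  D⋗X : Covers D₀ D X
  D⋗X = move-covers D→X extends
    where
    extends : ∀ p → s < p → p < r' → HasCellRightOf D p c
    extends p s<p p<r' with <-cmp p r
    ... | tri< p<r _ _  = proj₂ (s-above p s<p p<r)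
    ... | tri≈ _ refl _ = c' , c<c' , corner
    ... | tri> _ _ r<p  = middle-extends p r<p p<r'

  X→Z : KohnertMoveAt X Z r c' t
  X→Z = relocate-move (∈-relocate⁺ corner (≢-row (<⇒≢ r<r')))
    (λ c₁ c'<c₁ → ∉-relocate (row-ends c₁ c'<c₁) (≢-row (>⇒≢ s<r)))
    1≤t t<r (∉-relocate t-empty (≢-col (>⇒≢ c<c')))
    (λ p t<p p<r → ∈-relocate⁺ (proj₁ (t-above p t<p p<r)) (≢-col (>⇒≢ c<c')))

  X⋗Z : Covers D₀ X Z
  X⋗Z = move-covers X→Z λ p t<p p<r →
    hasCellRightOf-map (λ _ _ pc₁∈ → ∈-relocate⁺ pc₁∈ (≢-row (<⇒≢ (<-trans p<r r<r'))))
      (proj₂ (t-above p t<p p<r))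

  D→Y : KohnertMoveAt D Y r c' t
  D→Y = relocate-move corner row-ends 1≤t t<r t-empty (λ p t<p p<r → proj₁ (t-above p t<p p<r))

  rc∈Y : (r , c) ∈ Y
  rc∈Y = ∈-relocate⁺ (column r ≤-refl (<⇒≤ r<r')) (≢-col (<⇒≢ c<c'))

  Y→Y' : KohnertMoveAt Y Y' r c s
  Y→Y' = relocate-move rc∈Y ends 1≤s s<r (∉-relocate s-empty (≢-col (<⇒≢ c<c')))
    (λ p s<p p<r → ∈-relocate⁺ (proj₁ (s-above p s<p p<r)) (≢-col (<⇒≢ c<c')))
    where
    ends : NoCellRightOf Y r c
    ends c₁ c<c₁ rc₁∈ with ∈-relocate⁻ rc₁∈ | <-cmp c₁ c'
    ... | inj₂ rc₁≡tc'    | _              = >⇒≢ t<r (,-injectiveˡ rc₁≡tc')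
    ... | inj₁ (rc₁∈D , _) | tri< c₁<c' _ _ = row-skips c₁ c<c₁ c₁<c' rc₁∈D
    ... | inj₁ (_ , ≢rc')  | tri≈ _ refl _  = ≢rc' refl
    ... | inj₁ (rc₁∈D , _) | tri> _ _ c'<c₁ = row-ends c₁ c'<c₁ rc₁∈D

  Y'→Z : KohnertMoveAt Y' Z r' c r
  Y'→Z = move-resp-≈ direct (≈D-trans
    (relocate-chain rc∈Y (≢-row (<⇒≢ r<r')) (≢-row (>⇒≢ (<-trans s<r r<r'))))
    (≈D-sym (relocate-comm (≢-col (>⇒≢ c<c')) (≢-col (<⇒≢ c<c')))))
    where
    direct : KohnertMoveAt Y' (relocate (r' , c) (r , c) Y') r' c r
    direct = relocate-move
      (∈-relocate⁺ (∈-relocate⁺ (column r' (<⇒≤ r<r') ≤-refl) (≢-row (>⇒≢ r<r'))) (≢-row (>⇒≢ r<r')))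
      (λ c₁ c<c₁ → ∉-relocate (∉-relocate (top-ends c₁ c<c₁) (≢-row (>⇒≢ (<-trans t<r r<r'))))
                              (≢-row (>⇒≢ (<-trans s<r r<r'))))
      (≤-trans 1≤s (<⇒≤ s<r)) r<r' (source-∉-relocate (≢-row (>⇒≢ s<r)))
      (λ p r<p p<r' → ∈-relocate⁺ (∈-relocate⁺ (column p (<⇒≤ r<p) (<⇒≤ p<r')) (≢-row (>⇒≢ r<p)))
                                  (≢-row (>⇒≢ r<p)))

  not-ranked : InKD D₀ D → ¬ Ranked D₀
  not-ranked D∈ = ¬Ranked-of-chains D∈ D⋗X X⋗Z (move⇒≺ Y'→Z) (move⇒≺ Y→Y') (move⇒≺ D→Y)

theorem3p4 : (D₀ : Diagram) → IsDiagram D₀ →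
    (D : Diagram) → InKD D₀ D →
    (r r' r₁ r₂ c c' : ℕ) →
    1 ≤ r₁ → 1 ≤ r₂ → r₁ < r → r₂ < r → r < r' → 1 ≤ c → c < c' →
    (∀ r̃ → r ≤ r̃ → r̃ ≤ r' → (r̃ , c) ∈ D) → (r , c') ∈ D →
    (∀ c̃ → c < c̃ → (r' , c̃) ∉ D) →
    (∀ r̃ → r < r̃ → r̃ < r' → ∃[ c̃ ] (c < c̃ × (r̃ , c̃) ∈ D)) →
    (∀ c̃ → c < c̃ → c̃ < c' → (r , c̃) ∉ D) →
    (∀ c̃ → c' < c̃ → (r , c̃) ∉ D) →
    (r₁ , c) ∉ D → (r₂ , c') ∉ D →
    ¬ Ranked D₀
theorem3p4 D₀ _ D D∈ r r' r₁ r₂ c c' 1≤r₁ 1≤r₂ r₁<r r₂<r r<r' _ c<c'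
  column corner top-ends middle-extends row-skips row-ends r₁∉ r₂∉
  with openGap c' 1≤r₂ r₂<r r₂∉
... | D₁ , D→D₁ , agree₁ , gap₁
  -- Column c' goes first: opening the gap of column c moves a cell of
  -- column c only, which lies left of every cell the gap of c' relies on.
  with openGap c 1≤r₁ r₁<r (r₁∉ ∘ from (agree₁ _ (inj₁ (<⇒≢ c<c'))))
... | D₂ , D₁→D₂ , agree₂ , gap₂ =
  TwoChains.not-ranked
    (Pattern-transfer (λ x → agree₂ x ∘ inj₂) (Pattern-transfer (λ x → agree₁ x ∘ inj₂) pat))
    gap₂
    (GapBelow-transfer (λ x → agree₂ x ∘ inj₁) c<c' gap₁)
    (D∈ ◅◅ D→D₁ ◅◅ D₁→D₂)
  where
  pat : Pattern D r r' c c'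
  pat = record
    { r<r' = r<r' ; c<c' = c<c' ; column = column ; corner = corner ; top-ends = top-ends
    ; middle-extends = middle-extends ; row-skips = row-skips ; row-ends = row-ends }
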